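{- Let $U=\mathcal W(0,1,p,q)$, $T=\mathcal W(1,0,p,q)$, and $x_n=U_n/U_{n-1}$ for $n\geq 2$. Choose a sequence $g=\mathcal W(i,j,s,t)$ for some $i,j\geq 2$. Then for every $n\geq 2$ $$U_{g_n}=a_2U^{(s)}_{g_{n-1}}T^{(-t)}_{g_{n-2}}+b_2T^{(s)}_{g_{n-1}}U^{(-t)}_{g_{n-2}}+(a_1b_2+a_2b_4)U^{(s)}_{g_{n-1}}U^{(-t)}_{g_{n-2}},$$ $$T_{g_n}=T^{(s)}_{g_{n-1}}T^{(-t)}_{g_{n-2}}+a_1U^{(s)}_{g_{n-1}}T^{(-t)}_{g_{n-2}}+b_1T^{(s)}_{g_{n-1}}U^{(-t)}_{g_{n-2}}+(a_1b_1+a_2b_3)U^{(s)}_{g_{n-1}}U^{(-t)}_{g_{n-2}},$$ where $U^{(s)}=\mathcal W(0,1,V_s,q^s)$, $T^{(s)}=\mathcal W(1,0,V_s,q^s)$ (and similarly with $-t$ in place of $s$), and $$M^s=\begin{pmatrix} a_1 & a_2 \cr a_3 & a_4\end{pmatrix},\qquad M^{ -t}=\begin{pmatrix} b_1 & b_2 \cr b_3 & b_4\end{pmatrix}.$$ Moreover, taking $x_i$ and $x_j$ as the initial steps of the acceleration of $x$, for all $n\geq 2$ $$x_{g_n}=\cfrac{q^2a_2x_{g_{n-1}}^{(s)}+q^2b_2x_{g_{n-2}}^{(-t)}-q(a_1b_2+a_2b_4)x_{g_{n-1}}^{(s)}x_{g_{n-2}}^{(-t)}}{q^2-qa_1x_{g_{n-1}}^{(s)}-qb_1x_{g_{n-2}}^{(-t)}+(a_1b_1+a_2b_3)x_{g_{n-1}}^{(s)}x_{g_{n-2}}^{(-t)}},$$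 where $x^{(s)}=-q\,U^{(s)}/T^{(s)}$ (and similarly $x^{(-t)}=-q\,U^{(-t)}/T^{(-t)}$).
   Context: Let $R$ be an integral domain with unit. For $\alpha,\beta,p,q\in R$, $\mathcal W(\alpha,\beta,p,q)$ denotes the linear recurrent sequence $(a_n)_{n\ge0}$ with $a_0=\alpha$, $a_1=\beta$, $a_n=pa_{n-1}-qa_{n-2}$ for $n\geq2$. $V=\mathcal W(2,p,p,q)$ is the Lucas sequence with parameters $p,q$, and $M=\begin{pmatrix} 0 & 1 \cr -q & p\end{pmatrix}$ is the companion matrix, so that $M^n=\begin{pmatrix} T_n & U_n \cr T_{n+1} & U_{n+1}\end{pmatrix}$. -}

module Defs where

open import Level using (Level; _⊔_) renaming (suc to lsuc)
open import Algebra.Bundles using (CommutativeRing)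
open import Data.Nat using (ℕ; zero; suc; _∸_)
open import Data.Integer as ℤ using (ℤ; +_; -[1+_])
open import Relation.Nullary using (¬_)

-- A field: a commutative ring with 1 ≠ 0 in which every nonzero element
-- has a multiplicative inverse.  (We work in the fraction field of the
-- paper's integral domain R.)
record Field (c ℓ : Level) : Set (lsuc (c ⊔ ℓ)) where
  field
    commutativeRing : CommutativeRing c ℓ
  open CommutativeRing commutativeRing public
  field
    1≉0     : ¬ (1# ≈ 0#)
    inv     : (x : Carrier) → ¬ (x ≈ 0#) → Carrier
    inverse : (x : Carrier) (nz : ¬ (x ≈ 0#)) → x * inv x nz ≈ 1#

Wℤ : ℤ → ℤ → ℤ → ℤ → ℕ → ℤ
Wℤ α β p q zero          = α
Wℤ α β p q (suc zero)    = β
Wℤ α β p q (suc (suc n)) = p ℤ.* Wℤ α β p q (suc n) ℤ.- q ℤ.* Wℤ α β p q n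

module Lucas {c ℓ : Level} (F : Field c ℓ) where
  open Field F

  infixl 6 _−_
  _−_ : Carrier → Carrier → Carrier
  a − b = a + (- b)

  div : Carrier → (b : Carrier) → ¬ (b ≈ 0#) → Carrier
  div a b nz = a * inv b nz

  two : Carrier
  two = 1# + 1#

  pow : Carrier → ℕ → Carrier
  pow a zero    = 1#
  pow a (suc n) = a * pow a n

  W : Carrier → Carrier → Carrier → Carrier → ℕ → Carrier
  W α β p q zero          = α
  W α β p q (suc zero)    = β
  W α β p q (suc (suc n)) = p * W α β p q (suc n) − q * W α β p q n

  record Mat2 : Set c where
    constructor mat
    field
      e11 e12 e21 e22 : Carrier
  open Mat2 public

  I₂ : Mat2
  I₂ = mat 1# 0# 0# 1#

  _⊗_ : Mat2 → Mat2 → Mat2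
  mat a b c' d ⊗ mat a' b' c'' d' =
    mat (a * a' + b * c'') (a * b' + b * d') (c' * a' + d * c'') (c' * b' + d * d')

  mpow : Mat2 → ℕ → Mat2
  mpow A zero    = I₂
  mpow A (suc n) = mpow A n ⊗ A

  module Params (p q : Carrier) (q≉0 : ¬ (q ≈ 0#)) where

    qinv : Carrier
    qinv = inv q q≉0

    U T V : ℕ → Carrier
    U = W 0# 1# p q
    T = W 1# 0# p q
    V = W two p p q

    M Minv : Mat2
    M    = mat 0# 1# (- q) p
    Minv = mat (p * qinv) (- qinv) 1# 0#

    Mpow : ℤ → Mat2
    Mpow (+ n)      = mpow M n
    Mpow -[1+ n ]   = mpow Minv (suc n)

    qz : ℤ → Carrier
    qz (+ n)      = pow q n
    qz -[1+ n ]   = pow qinv (suc n)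

    Vz : ℤ → Carrier
    Vz (+ n)      = V n
    Vz -[1+ n ]   = V (suc n) * pow qinv (suc n)

    Ue Te : ℤ → ℕ → Carrier
    Ue e = W 0# 1# (Vz e) (qz e)
    Te e = W 1# 0# (Vz e) (qz e)

    x : (n : ℕ) → ¬ (U (n ∸ 1) ≈ 0#) → Carrier
    x n nz = div (U n) (U (n ∸ 1)) nz

    xe : (e : ℤ) (n : ℕ) → ¬ (Te e n ≈ 0#) → Carrier
    xe e n nz = div (- q * Ue e n) (Te e n) nz

module Submission where

open import Defs
open import Data.Nat using (ℕ; suc; _∸_)
open import Data.Integer as ℤ using (ℤ; +_; ∣_∣)
open import Data.Product using (_×_)
open import Relation.Nullary using (¬_)

open import Algebra.Bundles using (CommutativeRing)
import Algebra.Solver.Ring.AlmostCommutativeRing as ACR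
open import Data.Nat using (zero)
import Data.Nat as Nat
import Data.Nat.Properties as NatP
open import Data.Integer using (-[1+_]; _⊖_)
import Data.Integer.Properties as ℤP
open import Data.Maybe using (Maybe; just; nothing)
open import Data.Product using (_,_)
open import Relation.Binary.Bundles using (Setoid)
import Relation.Binary.PropositionalEquality as P
open P using (_≡_)
open import Relation.Nullary using (yes; no)

-- Theorem 2.6.  For the companion matrix M, Cayley–Hamilton gives
-- Mⁿ = T_n·I + U_n·M, so U_G and T_G are entries of M^G.  If
-- G = s·A - t·B (the recurrence of g), the exponent laws for ℤ-powers of
-- the invertible M give M^G = (Mˢ)^A (M⁻ᵗ)^B, and Cayley–Hamilton for Mᵉ
-- (trace V_e, determinant q^e) expands (Mᵉ)ⁿ = T⁽ᵉ⁾_n·I + U⁽ᵉ⁾_n·Mᵉ.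
-- Multiplying the two expansions and reading off entries (1,2) and (1,1)
-- gives the formulas for U_G and T_G; the formula for x_G follows by
-- substituting x⁽ᵉ⁾ T⁽ᵉ⁾ = -q U⁽ᵉ⁾, clearing denominators and using
-- T_G = -q U_{G-1}.

-- In every commutative ring the canonical map ℤ → R is a ring morphism;
-- with it the ring solver normalises polynomial identities with
-- integer coefficients.
module IntegerCoefficients {c ℓ} (R : CommutativeRing c ℓ) where
  open CommutativeRing R
  open import Algebra.Properties.Semiring.Mult.TCOptimised semiring using (×-homo-+; 1+×) renaming (_×_ to _×ᴿ_)
  open import Algebra.Properties.Ring ring using (-‿distribˡ-*)
  open import Algebra.Properties.AbelianGroup +-abelianGroup using (⁻¹-∙-comm; ⁻¹-involutive; ε⁻¹≈ε)
  open import Algebra.Properties.CommutativeSemigroup +-commutativeSemigroup using (interchange)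
  open import Relation.Binary.Reasoning.Setoid setoid

  ⟦_⟧ᶻ : ℤ → Carrier
  ⟦ + n ⟧ᶻ      = n ×ᴿ 1#
  ⟦ -[1+ n ] ⟧ᶻ = - (suc n ×ᴿ 1#)

  -‿homoᶻ : ∀ i → ⟦ ℤ.- i ⟧ᶻ ≈ - ⟦ i ⟧ᶻ
  -‿homoᶻ (+ zero)  = sym ε⁻¹≈ε
  -‿homoᶻ (+ suc n) = refl
  -‿homoᶻ -[1+ n ]  = sym (⁻¹-involutive _)

  cancel-1# : ∀ a b → (1# + a) + - (1# + b) ≈ a + - b
  cancel-1# a b = begin
    (1# + a) + - (1# + b)   ≈⟨ +-congˡ (sym (⁻¹-∙-comm 1# b)) ⟩
    (1# + a) + (- 1# + - b) ≈⟨ interchange 1# a (- 1#) (- b) ⟩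
    (1# + - 1#) + (a + - b) ≈⟨ +-congʳ (-‿inverseʳ 1#) ⟩
    0# + (a + - b)          ≈⟨ +-identityˡ _ ⟩
    a + - b                 ∎

  ⊖-homo : ∀ m n → ⟦ m ⊖ n ⟧ᶻ ≈ m ×ᴿ 1# + - (n ×ᴿ 1#)
  ⊖-homo m       zero    = sym (trans (+-congˡ ε⁻¹≈ε) (+-identityʳ _))
  ⊖-homo zero    (suc n) = sym (+-identityˡ _)
  ⊖-homo (suc m) (suc n) rewrite ℤP.[1+m]⊖[1+n]≡m⊖n m n = begin
    ⟦ m ⊖ n ⟧ᶻ                          ≈⟨ ⊖-homo m n ⟩
    m ×ᴿ 1# + - (n ×ᴿ 1#)               ≈⟨ cancel-1# (m ×ᴿ 1#) (n ×ᴿ 1#) ⟨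
    (1# + m ×ᴿ 1#) + - (1# + n ×ᴿ 1#)   ≈⟨ +-cong (1+× m 1#) (-‿cong (1+× n 1#)) ⟨
    suc m ×ᴿ 1# + - (suc n ×ᴿ 1#)       ∎

  +-homoᶻ : ∀ i j → ⟦ i ℤ.+ j ⟧ᶻ ≈ ⟦ i ⟧ᶻ + ⟦ j ⟧ᶻ
  +-homoᶻ (+ m)    (+ n)    = ×-homo-+ 1# m n
  +-homoᶻ (+ m)    -[1+ n ] = ⊖-homo m (suc n)
  +-homoᶻ -[1+ m ] (+ n)    = trans (⊖-homo n (suc m)) (+-comm _ _)
  +-homoᶻ -[1+ m ] -[1+ n ] = begin
    - (suc (suc (m Nat.+ n)) ×ᴿ 1#)     ≈⟨ -‿cong (reflexive (P.cong (_×ᴿ 1#) (P.sym (NatP.+-suc (suc m) n)))) ⟩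
    - ((suc m Nat.+ suc n) ×ᴿ 1#)       ≈⟨ -‿cong (×-homo-+ 1# (suc m) (suc n)) ⟩
    - (suc m ×ᴿ 1# + suc n ×ᴿ 1#)       ≈⟨ ⁻¹-∙-comm _ _ ⟨
    - (suc m ×ᴿ 1#) + - (suc n ×ᴿ 1#)   ∎

  *-homo-+ᶻ : ∀ m j → ⟦ + m ℤ.* j ⟧ᶻ ≈ m ×ᴿ 1# * ⟦ j ⟧ᶻ
  *-homo-+ᶻ zero    j = sym (zeroˡ _)
  *-homo-+ᶻ (suc m) j = begin
    ⟦ + suc m ℤ.* j ⟧ᶻ               ≡⟨ P.cong ⟦_⟧ᶻ (ℤP.suc-* (+ m) j) ⟩
    ⟦ j ℤ.+ + m ℤ.* j ⟧ᶻ             ≈⟨ +-homoᶻ j (+ m ℤ.* j) ⟩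
    ⟦ j ⟧ᶻ + ⟦ + m ℤ.* j ⟧ᶻ          ≈⟨ +-cong (sym (*-identityˡ _)) (*-homo-+ᶻ m j) ⟩
    1# * ⟦ j ⟧ᶻ + m ×ᴿ 1# * ⟦ j ⟧ᶻ   ≈⟨ distribʳ _ _ _ ⟨
    (1# + m ×ᴿ 1#) * ⟦ j ⟧ᶻ          ≈⟨ *-congʳ (1+× m 1#) ⟨
    suc m ×ᴿ 1# * ⟦ j ⟧ᶻ             ∎

  *-homoᶻ : ∀ i j → ⟦ i ℤ.* j ⟧ᶻ ≈ ⟦ i ⟧ᶻ * ⟦ j ⟧ᶻ
  *-homoᶻ (+ m)    j = *-homo-+ᶻ m j
  *-homoᶻ -[1+ m ] j = begin
    ⟦ -[1+ m ] ℤ.* j ⟧ᶻ              ≡⟨ P.cong ⟦_⟧ᶻ (ℤP.neg-distribˡ-* (+ suc m) j) ⟨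
    ⟦ ℤ.- (+ suc m ℤ.* j) ⟧ᶻ         ≈⟨ -‿homoᶻ (+ suc m ℤ.* j) ⟩
    - ⟦ + suc m ℤ.* j ⟧ᶻ             ≈⟨ -‿cong (*-homo-+ᶻ (suc m) j) ⟩
    - (suc m ×ᴿ 1# * ⟦ j ⟧ᶻ)         ≈⟨ -‿distribˡ-* _ _ ⟩
    - (suc m ×ᴿ 1#) * ⟦ j ⟧ᶻ         ∎

  morphism : ℤ.+-*-rawRing ACR.-Raw-AlmostCommutative⟶ ACR.fromCommutativeRing R
  morphism = record
    { ⟦_⟧ = ⟦_⟧ᶻ ; +-homo = +-homoᶻ ; *-homo = *-homoᶻ ; -‿homo = -‿homoᶻ
    ; 0-homo = refl ; 1-homo = refl }

  -- equal integer coefficients have equal images (the solver needs only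
  -- this weak decision procedure)
  coeff≟ : ∀ i j → Maybe (⟦ i ⟧ᶻ ≈ ⟦ j ⟧ᶻ)
  coeff≟ i j with i ℤ.≟ j
  ... | yes P.refl = just refl
  ... | no _       = nothing

  open import Algebra.Solver.Ring ℤ.+-*-rawRing (ACR.fromCommutativeRing R) morphism coeff≟ public
    using (solve; _:=_; _:+_; _:*_; :-_; _:-_; con)

module FieldFacts {c ℓ} (F : Field c ℓ) where
  open Field F
  open Lucas F using (div)
  open IntegerCoefficients commutativeRing
  open import Relation.Binary.Reasoning.Setoid setoid

  *-cancelʳ : ∀ {k x y} → ¬ (k ≈ 0#) → x * k ≈ y * k → x ≈ y
  *-cancelʳ {k} {x} {y} k≉0 xk≈yk = begin
    x                  ≈⟨ *-identityʳ x ⟨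
    x * 1#             ≈⟨ *-congˡ (inverse k k≉0) ⟨
    x * (k * k⁻¹)      ≈⟨ *-assoc x k k⁻¹ ⟨
    x * k * k⁻¹        ≈⟨ *-congʳ xk≈yk ⟩
    y * k * k⁻¹        ≈⟨ *-assoc y k k⁻¹ ⟩
    y * (k * k⁻¹)      ≈⟨ *-congˡ (inverse k k≉0) ⟩
    y * 1#             ≈⟨ *-identityʳ y ⟩
    y                  ∎
    where
    k⁻¹ : Carrier
    k⁻¹ = inv k k≉0

  div-*-cancel : ∀ a b (b≉0 : ¬ (b ≈ 0#)) → div a b b≉0 * b ≈ a
  div-*-cancel a b b≉0 = begin
    a * inv b b≉0 * b    ≈⟨ *-assoc a _ b ⟩
    a * (inv b b≉0 * b)  ≈⟨ *-congˡ (*-comm _ b) ⟩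
    a * (b * inv b b≉0)  ≈⟨ *-congˡ (inverse b b≉0) ⟩
    a * 1#               ≈⟨ *-identityʳ a ⟩
    a                    ∎

  div-cross : ∀ a b c' d (b≉0 : ¬ (b ≈ 0#)) (d≉0 : ¬ (d ≈ 0#)) →
              a * d ≈ c' * b → div a b b≉0 ≈ div c' d d≉0
  div-cross a b c' d b≉0 d≉0 ad≈cb = *-cancelʳ d≉0 (*-cancelʳ b≉0 (begin
    X * d * b     ≈⟨ solve 3 (λ X d b → X :* d :* b := X :* b :* d) refl X d b ⟩
    X * b * d     ≈⟨ *-congʳ (div-*-cancel a b b≉0) ⟩
    a * d         ≈⟨ ad≈cb ⟩
    c' * b        ≈⟨ *-congʳ (div-*-cancel c' d d≉0) ⟨
    Y * d * b     ∎))
    where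
    X Y : Carrier
    X = div a b b≉0
    Y = div c' d d≉0

module Sequences {c ℓ} (F : Field c ℓ) where
  open Field F
  open Lucas F
  open IntegerCoefficients commutativeRing
  open import Relation.Binary.Reasoning.Setoid setoid

  Tseq Useq : Carrier → Carrier → ℕ → Carrier
  Tseq τ δ = W 1# 0# τ δ
  Useq τ δ = W 0# 1# τ δ

  pow-cong : ∀ {a b} → a ≈ b → ∀ n → pow a n ≈ pow b n
  pow-cong a≈b zero    = refl
  pow-cong a≈b (suc n) = *-cong a≈b (pow-cong a≈b n)

  T-suc : ∀ τ δ n → Tseq τ δ (suc n) ≈ - δ * Useq τ δ n
  U-suc : ∀ τ δ n → Useq τ δ (suc n) ≈ Tseq τ δ n + τ * Useq τ δ n

  T-suc τ δ zero    = solve 1 (λ δ → con (+ 0) := :- δ :* con (+ 0)) refl δ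
  T-suc τ δ (suc n) = begin
    τ * Tseq τ δ (suc n) − δ * Tseq τ δ n         ≈⟨ +-congʳ (*-congˡ (T-suc τ δ n)) ⟩
    τ * (- δ * Useq τ δ n) − δ * Tseq τ δ n       ≈⟨ solve 4 (λ τ δ t u → τ :* (:- δ :* u) :- δ :* t
                                                                   := :- δ :* (t :+ τ :* u)) refl τ δ (Tseq τ δ n) (Useq τ δ n) ⟩
    - δ * (Tseq τ δ n + τ * Useq τ δ n)           ≈⟨ *-congˡ (U-suc τ δ n) ⟨
    - δ * Useq τ δ (suc n)                        ∎

  U-suc τ δ zero    = solve 1 (λ τ → con (+ 1) := con (+ 1) :+ τ :* con (+ 0)) refl τ
  U-suc τ δ (suc n) = begin
    τ * Useq τ δ (suc n) − δ * Useq τ δ n         ≈⟨ +-comm _ _ ⟩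
    - (δ * Useq τ δ n) + τ * Useq τ δ (suc n)     ≈⟨ +-congʳ (-‿distribˡ-* δ _) ⟩
    - δ * Useq τ δ n + τ * Useq τ δ (suc n)       ≈⟨ +-congʳ (T-suc τ δ n) ⟨
    Tseq τ δ (suc n) + τ * Useq τ δ (suc n)       ∎
    where open import Algebra.Properties.Ring ring using (-‿distribˡ-*)

  trace-seq : ∀ τ δ n → two * Tseq τ δ n + τ * Useq τ δ n ≈ W two τ τ δ n
  trace-seq τ δ zero          = solve 1 (λ τ → (con (+ 1) :+ con (+ 1)) :* con (+ 1) :+ τ :* con (+ 0)
                                              := con (+ 1) :+ con (+ 1)) refl τ
  trace-seq τ δ (suc zero)    = solve 1 (λ τ → (con (+ 1) :+ con (+ 1)) :* con (+ 0) :+ τ :* con (+ 1) := τ) refl τ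
  trace-seq τ δ (suc (suc n)) = begin
    two * (τ * t₁ − δ * t₀) + τ * (τ * u₁ − δ * u₀)
      ≈⟨ solve 6 (λ τ δ t₀ t₁ u₀ u₁ →
           (con (+ 1) :+ con (+ 1)) :* (τ :* t₁ :- δ :* t₀) :+ τ :* (τ :* u₁ :- δ :* u₀)
           := τ :* ((con (+ 1) :+ con (+ 1)) :* t₁ :+ τ :* u₁) :- δ :* ((con (+ 1) :+ con (+ 1)) :* t₀ :+ τ :* u₀))
           refl τ δ t₀ t₁ u₀ u₁ ⟩
    τ * (two * t₁ + τ * u₁) − δ * (two * t₀ + τ * u₀)
      ≈⟨ +-cong (*-congˡ (trace-seq τ δ (suc n))) (-‿cong (*-congˡ (trace-seq τ δ n))) ⟩
    τ * W two τ τ δ (suc n) − δ * W two τ τ δ n ∎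
    where
    t₀ t₁ u₀ u₁ : Carrier
    t₀ = Tseq τ δ n
    t₁ = Tseq τ δ (suc n)
    u₀ = Useq τ δ n
    u₁ = Useq τ δ (suc n)

  W-scale : ∀ l α β τ δ n → W α (l * β) (l * τ) (l * l * δ) n ≈ pow l n * W α β τ δ n
  W-scale l α β τ δ zero          = solve 1 (λ α → α := con (+ 1) :* α) refl α
  W-scale l α β τ δ (suc zero)    = solve 2 (λ l β → l :* β := l :* con (+ 1) :* β) refl l β
  W-scale l α β τ δ (suc (suc n)) = begin
    l * τ * W' (suc n) − l * l * δ * W' n
      ≈⟨ +-cong (*-congˡ (W-scale l α β τ δ (suc n))) (-‿cong (*-congˡ (W-scale l α β τ δ n))) ⟩
    l * τ * (l * lⁿ * w₁) − l * l * δ * (lⁿ * w₀)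
      ≈⟨ solve 6 (λ l lⁿ τ δ w₀ w₁ → l :* τ :* (l :* lⁿ :* w₁) :- l :* l :* δ :* (lⁿ :* w₀)
                   := l :* (l :* lⁿ) :* (τ :* w₁ :- δ :* w₀)) refl l lⁿ τ δ w₀ w₁ ⟩
    l * (l * lⁿ) * (τ * w₁ − δ * w₀) ∎
    where
    W' : ℕ → Carrier
    W' = W α (l * β) (l * τ) (l * l * δ)
    lⁿ w₀ w₁ : Carrier
    lⁿ = pow l n
    w₀ = W α β τ δ n
    w₁ = W α β τ δ (suc n)

module Matrices {c ℓ} (F : Field c ℓ) where
  open Field F
  open Lucas F
  open Sequences F
  open IntegerCoefficients commutativeRing

  infix 4 _≋_
  record _≋_ (A B : Mat2) : Set ℓ where
    constructor meq
    field
      eq11 : e11 A ≈ e11 B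
      eq12 : e12 A ≈ e12 B
      eq21 : e21 A ≈ e21 B
      eq22 : e22 A ≈ e22 B
  open _≋_ public

  ≋-setoid : Setoid c ℓ
  ≋-setoid = record
    { Carrier       = Mat2
    ; _≈_           = _≋_
    ; isEquivalence = record
      { refl  = meq refl refl refl refl
      ; sym   = λ (meq a b c' d) → meq (sym a) (sym b) (sym c') (sym d)
      ; trans = λ (meq a b c' d) (meq a' b' c'' d') →
                  meq (trans a a') (trans b b') (trans c' c'') (trans d d')
      }
    }
  open Setoid ≋-setoid public using () renaming (refl to ≋-refl; sym to ≋-sym; trans to ≋-trans; reflexive to ≋-reflexive)

  ⊗-cong : ∀ {A A' B B'} → A ≋ A' → B ≋ B' → A ⊗ B ≋ A' ⊗ B'
  ⊗-cong (meq a b c' d) (meq a' b' c'' d') =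
    meq (+-cong (*-cong a a') (*-cong b c'')) (+-cong (*-cong a b') (*-cong b d'))
        (+-cong (*-cong c' a') (*-cong d c'')) (+-cong (*-cong c' b') (*-cong d d'))

  ⊗-assoc : ∀ A B C → (A ⊗ B) ⊗ C ≋ A ⊗ (B ⊗ C)
  ⊗-assoc A B C = meq (entry _ _ _ _ _ _ _ _) (entry _ _ _ _ _ _ _ _)
                      (entry _ _ _ _ _ _ _ _) (entry _ _ _ _ _ _ _ _)
    where
    entry : ∀ a b a' b' c' d' x z →
            (a * a' + b * c') * x + (a * b' + b * d') * z ≈ a * (a' * x + b' * z) + b * (c' * x + d' * z)
    entry = solve 8 (λ a b a' b' c' d' x z →
      (a :* a' :+ b :* c') :* x :+ (a :* b' :+ b :* d') :* z
      := a :* (a' :* x :+ b' :* z) :+ b :* (c' :* x :+ d' :* z)) refl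

  ⊗-identityˡ : ∀ A → I₂ ⊗ A ≋ A
  ⊗-identityˡ A = meq (entry _ _) (entry _ _) (entry′ _ _) (entry′ _ _)
    where
    entry : ∀ a c' → 1# * a + 0# * c' ≈ a
    entry′ : ∀ a c' → 0# * a + 1# * c' ≈ c'
    entry  = solve 2 (λ a c' → con (+ 1) :* a :+ con (+ 0) :* c' := a) refl
    entry′ = solve 2 (λ a c' → con (+ 0) :* a :+ con (+ 1) :* c' := c') refl

  ⊗-identityʳ : ∀ A → A ⊗ I₂ ≋ A
  ⊗-identityʳ A = meq (entry _ _) (entry′ _ _) (entry _ _) (entry′ _ _)
    where
    entry : ∀ a b → a * 1# + b * 0# ≈ a
    entry′ : ∀ a b → a * 0# + b * 1# ≈ b
    entry  = solve 2 (λ a b → a :* con (+ 1) :+ b :* con (+ 0) := a) refl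
    entry′ = solve 2 (λ a b → a :* con (+ 0) :+ b :* con (+ 1) := b) refl

  trace det : Mat2 → Carrier
  trace A = e11 A + e22 A
  det A   = e11 A * e22 A − e12 A * e21 A

  linI : Carrier → Carrier → Mat2 → Mat2
  linI t u A = mat (t + u * e11 A) (u * e12 A) (u * e21 A) (t + u * e22 A)

  linI-cong : ∀ {t t' u u'} A → t ≈ t' → u ≈ u' → linI t u A ≋ linI t' u' A
  linI-cong A t≈ u≈ = meq (+-cong t≈ (*-congʳ u≈)) (*-congʳ u≈) (*-congʳ u≈) (+-cong t≈ (*-congʳ u≈))

  det-⊗ : ∀ A B → det (A ⊗ B) ≈ det A * det B
  det-⊗ (mat a b c' d) (mat a' b' c'' d') =
    solve 8 (λ a b c d a' b' c' d' →
      (a :* a' :+ b :* c') :* (c :* b' :+ d :* d') :- (a :* b' :+ b :* d') :* (c :* a' :+ d :* c')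
      := (a :* d :- b :* c) :* (a' :* d' :- b' :* c')) refl a b c' d a' b' c'' d'

  det-mpow : ∀ A n → det (mpow A n) ≈ pow (det A) n
  det-mpow A zero    = solve 0 (con (+ 1) :* con (+ 1) :- con (+ 0) :* con (+ 0) := con (+ 1)) refl
  det-mpow A (suc n) = trans (det-⊗ (mpow A n) A) (trans (*-congʳ (det-mpow A n)) (*-comm _ _))

  module _ (A : Mat2) {τ δ : Carrier} (τ≈ : τ ≈ trace A) (δ≈ : δ ≈ det A) where
    open import Relation.Binary.Reasoning.Setoid ≋-setoid

    -- (t I + u A) A = -δu I + (t + τu) A, since A² = τA - δI
    linI-⊗ : ∀ t u → linI t u A ⊗ A ≋ linI (- δ * u) (t + τ * u) A
    linI-⊗ t u = begin
      linI t u A ⊗ A                                  ≈⟨ meq entry₁ entry₂ entry₃ entry₄ ⟩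
      linI (- det A * u) (t + trace A * u) A          ≈⟨ linI-cong A (*-congʳ (-‿cong δ≈)) (+-congˡ (*-congʳ τ≈)) ⟨
      linI (- δ * u) (t + τ * u) A                    ∎
      where
      a b c' d : Carrier
      a = e11 A
      b = e12 A
      c' = e21 A
      d = e22 A
      entry₁ : (t + u * a) * a + u * b * c' ≈ - (a * d − b * c') * u + (t + (a + d) * u) * a
      entry₁ = solve 6 (λ a b c d t u → (t :+ u :* a) :* a :+ u :* b :* c
                         := :- (a :* d :- b :* c) :* u :+ (t :+ (a :+ d) :* u) :* a) refl a b c' d t u
      entry₂ : (t + u * a) * b + u * b * d ≈ (t + (a + d) * u) * b
      entry₂ = solve 5 (λ a b d t u → (t :+ u :* a) :* b :+ u :* b :* d
                         := (t :+ (a :+ d) :* u) :* b) refl a b d t u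
      entry₃ : u * c' * a + (t + u * d) * c' ≈ (t + (a + d) * u) * c'
      entry₃ = solve 5 (λ a c d t u → u :* c :* a :+ (t :+ u :* d) :* c
                         := (t :+ (a :+ d) :* u) :* c) refl a c' d t u
      entry₄ : u * c' * b + (t + u * d) * d ≈ - (a * d − b * c') * u + (t + (a + d) * u) * d
      entry₄ = solve 6 (λ a b c d t u → u :* c :* b :+ (t :+ u :* d) :* d
                         := :- (a :* d :- b :* c) :* u :+ (t :+ (a :+ d) :* u) :* d) refl a b c' d t u

    cayley-hamilton : ∀ n → mpow A n ≋ linI (Tseq τ δ n) (Useq τ δ n) A
    cayley-hamilton zero    = meq (diagonal (e11 A)) (off-diagonal (e12 A)) (off-diagonal (e21 A)) (diagonal (e22 A))
      where
      diagonal : ∀ a → 1# ≈ 1# + 0# * a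
      diagonal = solve 1 (λ a → con (+ 1) := con (+ 1) :+ con (+ 0) :* a) refl
      off-diagonal : ∀ a → 0# ≈ 0# * a
      off-diagonal = solve 1 (λ a → con (+ 0) := con (+ 0) :* a) refl
    cayley-hamilton (suc n) = begin
      mpow A n ⊗ A                                    ≈⟨ ⊗-cong (cayley-hamilton n) ≋-refl ⟩
      linI t u A ⊗ A                                  ≈⟨ linI-⊗ t u ⟩
      linI (- δ * u) (t + τ * u) A                    ≈⟨ linI-cong A (T-suc τ δ n) (U-suc τ δ n) ⟨
      linI (Tseq τ δ (suc n)) (Useq τ δ (suc n)) A    ∎
      where
      t u : Carrier
      t = Tseq τ δ n
      u = Useq τ δ n

    trace-mpow : ∀ n → trace (mpow A n) ≈ W two τ τ δ n
    trace-mpow n = trans (+-cong (eq11 ch) (eq22 ch)) (trans tr-linI (trace-seq τ δ n))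
      where
      ch : mpow A n ≋ linI (Tseq τ δ n) (Useq τ δ n) A
      ch = cayley-hamilton n
      t u : Carrier
      t = Tseq τ δ n
      u = Useq τ δ n
      tr-linI : (t + u * e11 A) + (t + u * e22 A) ≈ two * t + τ * u
      tr-linI = trans (solve 4 (λ a d t u → (t :+ u :* a) :+ (t :+ u :* d)
                                  := (con (+ 1) :+ con (+ 1)) :* t :+ (a :+ d) :* u) refl (e11 A) (e22 A) t u)
                      (+-congˡ (*-congʳ (sym τ≈)))

module IntegerPowers {c ℓ} (F : Field c ℓ) where
  open Lucas F
  open Matrices F

  module _ (A B : Mat2) (A⊗B : A ⊗ B ≋ I₂) (B⊗A : B ⊗ A ≋ I₂) where
    open import Relation.Binary.Reasoning.Setoid ≋-setoid

    zpow : ℤ → Mat2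
    zpow (+ n)    = mpow A n
    zpow -[1+ n ] = mpow B (suc n)

    cancel-pair : ∀ X {Y Z} → Y ⊗ Z ≋ I₂ → (X ⊗ Y) ⊗ Z ≋ X
    cancel-pair X {Y} {Z} Y⊗Z = begin
      (X ⊗ Y) ⊗ Z    ≈⟨ ⊗-assoc X Y Z ⟩
      X ⊗ (Y ⊗ Z)    ≈⟨ ⊗-cong ≋-refl Y⊗Z ⟩
      X ⊗ I₂         ≈⟨ ⊗-identityʳ X ⟩
      X              ∎

    zpow-suc : ∀ i → zpow (ℤ.suc i) ≋ zpow i ⊗ A
    zpow-suc (+ n)         = ≋-refl
    zpow-suc -[1+ zero ]   = ≋-sym (cancel-pair I₂ B⊗A)
    zpow-suc -[1+ suc n ]  = ≋-sym (cancel-pair (mpow B (suc n)) B⊗A)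

    zpow-pred : ∀ i → zpow (ℤ.pred i) ≋ zpow i ⊗ B
    zpow-pred i = begin
      zpow (ℤ.pred i)                  ≈⟨ cancel-pair (zpow (ℤ.pred i)) A⊗B ⟨
      (zpow (ℤ.pred i) ⊗ A) ⊗ B        ≈⟨ ⊗-cong (zpow-suc (ℤ.pred i)) ≋-refl ⟨
      zpow (ℤ.suc (ℤ.pred i)) ⊗ B      ≡⟨ P.cong (λ k → zpow k ⊗ B) (ℤP.suc-pred i) ⟩
      zpow i ⊗ B                       ∎

    zpow-+ : ∀ i j → zpow (i ℤ.+ j) ≋ zpow i ⊗ zpow j
    zpow-+ i (+ zero) = begin
      zpow (i ℤ.+ + 0)                 ≡⟨ P.cong zpow (ℤP.+-identityʳ i) ⟩
      zpow i                           ≈⟨ ⊗-identityʳ (zpow i) ⟨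
      zpow i ⊗ I₂                      ∎
    zpow-+ i (+ suc n) = begin
      zpow (i ℤ.+ ℤ.suc (+ n))         ≡⟨ P.cong zpow (+-sucʳ i (+ n)) ⟩
      zpow (ℤ.suc (i ℤ.+ + n))         ≈⟨ zpow-suc (i ℤ.+ + n) ⟩
      zpow (i ℤ.+ + n) ⊗ A             ≈⟨ ⊗-cong (zpow-+ i (+ n)) ≋-refl ⟩
      (zpow i ⊗ mpow A n) ⊗ A          ≈⟨ ⊗-assoc _ _ _ ⟩
      zpow i ⊗ mpow A (suc n)          ∎
      where
      +-sucʳ : ∀ i j → i ℤ.+ ℤ.suc j ≡ ℤ.suc (i ℤ.+ j)
      +-sucʳ i j = P.trans (P.sym (ℤP.+-assoc i ℤ.1ℤ j))
                   (P.trans (P.cong (ℤ._+ j) (ℤP.+-comm i ℤ.1ℤ)) (ℤP.+-assoc ℤ.1ℤ i j))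
    zpow-+ i -[1+ zero ] = begin
      zpow (i ℤ.+ ℤ.-1ℤ)               ≡⟨ P.cong zpow (ℤP.+-comm i ℤ.-1ℤ) ⟩
      zpow (ℤ.pred i)                  ≈⟨ zpow-pred i ⟩
      zpow i ⊗ B                       ≈⟨ ⊗-cong ≋-refl (⊗-identityˡ B) ⟨
      zpow i ⊗ (I₂ ⊗ B)                ∎
    zpow-+ i -[1+ suc n ] = begin
      zpow (i ℤ.+ ℤ.pred -[1+ n ])     ≡⟨ P.cong zpow (ℤP.+-pred i -[1+ n ]) ⟩
      zpow (ℤ.pred (i ℤ.+ -[1+ n ]))   ≈⟨ zpow-pred (i ℤ.+ -[1+ n ]) ⟩
      zpow (i ℤ.+ -[1+ n ]) ⊗ B        ≈⟨ ⊗-cong (zpow-+ i -[1+ n ]) ≋-refl ⟩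
      (zpow i ⊗ mpow B (suc n)) ⊗ B    ≈⟨ ⊗-assoc _ _ _ ⟩
      zpow i ⊗ mpow B (suc (suc n))    ∎

    zpow-* : ∀ i n → zpow (i ℤ.* + n) ≋ mpow (zpow i) n
    zpow-* i zero    = ≋-reflexive (P.cong zpow (ℤP.*-zeroʳ i))
    zpow-* i (suc n) = begin
      zpow (i ℤ.* ℤ.suc (+ n))         ≡⟨ P.cong zpow (P.trans (ℤP.*-suc i (+ n)) (ℤP.+-comm i _)) ⟩
      zpow (i ℤ.* + n ℤ.+ i)           ≈⟨ zpow-+ (i ℤ.* + n) i ⟩
      zpow (i ℤ.* + n) ⊗ zpow i        ≈⟨ ⊗-cong (zpow-* i n) ≋-refl ⟩
      mpow (zpow i) n ⊗ zpow i         ∎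

module LucasMatrix {c ℓ} (F : Field c ℓ) (p q : Field.Carrier F) (q≉0 : ¬ (Field._≈_ F q (Field.0# F))) where
  open Field F
  open Lucas F
  open Params p q q≉0
  open Sequences F
  open Matrices F
  open IntegerPowers F
  open IntegerCoefficients commutativeRing

  -- Minv is the inverse of M (this is where q ≠ 0 is used)
  q·q⁻¹ : q * qinv ≈ 1#
  q·q⁻¹ = inverse q q≉0

  M⊗Minv : M ⊗ Minv ≋ I₂
  M⊗Minv = meq (solve 2 (λ p q⁻¹ → con (+ 0) :* (p :* q⁻¹) :+ con (+ 1) :* con (+ 1) := con (+ 1)) refl p qinv)
               (solve 1 (λ q⁻¹ → con (+ 0) :* (:- q⁻¹) :+ con (+ 1) :* con (+ 0) := con (+ 0)) refl qinv)
               (begin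
                  - q * (p * qinv) + p * 1#   ≈⟨ solve 3 (λ p q q⁻¹ → :- q :* (p :* q⁻¹) :+ p :* con (+ 1)
                                                            := p :- p :* (q :* q⁻¹)) refl p q qinv ⟩
                  p − p * (q * qinv)          ≈⟨ +-congˡ (-‿cong (*-congˡ q·q⁻¹)) ⟩
                  p − p * 1#                  ≈⟨ solve 1 (λ p → p :- p :* con (+ 1) := con (+ 0)) refl p ⟩
                  0#                          ∎)
               (trans (solve 3 (λ p q q⁻¹ → :- q :* :- q⁻¹ :+ p :* con (+ 0) := q :* q⁻¹) refl p q qinv) q·q⁻¹)
    where open import Relation.Binary.Reasoning.Setoid setoid

  Minv⊗M : Minv ⊗ M ≋ I₂
  Minv⊗M = meq (trans (solve 3 (λ p q q⁻¹ → p :* q⁻¹ :* con (+ 0) :+ :- q⁻¹ :* :- q := q :* q⁻¹) refl p q qinv) q·q⁻¹)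
               (solve 2 (λ p q⁻¹ → p :* q⁻¹ :* con (+ 1) :+ :- q⁻¹ :* p := con (+ 0)) refl p qinv)
               (solve 1 (λ q → con (+ 1) :* con (+ 0) :+ con (+ 0) :* :- q := con (+ 0)) refl q)
               (solve 1 (λ p → con (+ 1) :* con (+ 1) :+ con (+ 0) :* p := con (+ 1)) refl p)

  Mᶻ : ℤ → Mat2
  Mᶻ = zpow M Minv M⊗Minv Minv⊗M

  Mpow≡Mᶻ : ∀ e → Mpow e ≡ Mᶻ e
  Mpow≡Mᶻ (+ n)    = P.refl
  Mpow≡Mᶻ -[1+ n ] = P.refl

  Mpow-+ : ∀ i j → Mpow (i ℤ.+ j) ≋ Mpow i ⊗ Mpow j
  Mpow-+ i j = begin
    Mpow (i ℤ.+ j)     ≡⟨ Mpow≡Mᶻ (i ℤ.+ j) ⟩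
    Mᶻ (i ℤ.+ j)       ≈⟨ zpow-+ M Minv M⊗Minv Minv⊗M i j ⟩
    Mᶻ i ⊗ Mᶻ j        ≡⟨ P.cong₂ _⊗_ (Mpow≡Mᶻ i) (Mpow≡Mᶻ j) ⟨
    Mpow i ⊗ Mpow j    ∎
    where open import Relation.Binary.Reasoning.Setoid ≋-setoid

  Mpow-* : ∀ i n → Mpow (i ℤ.* + n) ≋ mpow (Mpow i) n
  Mpow-* i n = begin
    Mpow (i ℤ.* + n)   ≡⟨ Mpow≡Mᶻ (i ℤ.* + n) ⟩
    Mᶻ (i ℤ.* + n)     ≈⟨ zpow-* M Minv M⊗Minv Minv⊗M i n ⟩
    mpow (Mᶻ i) n      ≡⟨ P.cong (λ X → mpow X n) (Mpow≡Mᶻ i) ⟨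
    mpow (Mpow i) n    ∎
    where open import Relation.Binary.Reasoning.Setoid ≋-setoid

  Mpow-split : ∀ s t G A B → + G ≡ s ℤ.* + A ℤ.- t ℤ.* + B →
               mpow M G ≋ mpow (Mpow s) A ⊗ mpow (Mpow (ℤ.- t)) B
  Mpow-split s t G A B G≡ =
    ≋-trans (≋-reflexive (P.cong Mpow G≡′)) (≋-trans (Mpow-+ (s ℤ.* + A) (ℤ.- t ℤ.* + B)) (⊗-cong (Mpow-* s A) (Mpow-* (ℤ.- t) B)))
    where
    G≡′ : + G ≡ s ℤ.* + A ℤ.+ ℤ.- t ℤ.* + B
    G≡′ = P.trans G≡ (P.cong (ℤ._+_ (s ℤ.* + A)) (ℤP.neg-distribˡ-* t (+ B)))

  trace-M : p ≈ trace M
  trace-M = sym (+-identityˡ p)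

  det-M : q ≈ det M
  det-M = solve 2 (λ p q → q := con (+ 0) :* p :- con (+ 1) :* :- q) refl p q

  trace-Minv : qinv * p ≈ trace Minv
  trace-Minv = solve 2 (λ p q⁻¹ → q⁻¹ :* p := p :* q⁻¹ :+ con (+ 0)) refl p qinv

  det-Minv : qinv ≈ det Minv
  det-Minv = solve 2 (λ p q⁻¹ → q⁻¹ := p :* q⁻¹ :* con (+ 0) :- (:- q⁻¹) :* con (+ 1)) refl p qinv

  -- tr Mᵉ = V_e, the defining property of the extension of V to ℤ
  trace-Mpow : ∀ e → Vz e ≈ trace (Mpow e)
  trace-Mpow (+ n)    = sym (trace-mpow M trace-M det-M n)
  trace-Mpow -[1+ n ] = begin
    V (suc n) * pow qinv (suc n)                              ≈⟨ *-comm _ _ ⟩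
    pow qinv (suc n) * V (suc n)                              ≈⟨ W-scale qinv two p p q (suc n) ⟨
    W two (qinv * p) (qinv * p) (qinv * qinv * q) (suc n)     ≈⟨ trace-mpow Minv trace-Minv det-Minv′ (suc n) ⟨
    trace (mpow Minv (suc n))                                 ∎
    where
    open import Relation.Binary.Reasoning.Setoid setoid
    det-Minv′ : qinv * qinv * q ≈ det Minv
    det-Minv′ = trans (trans (*-assoc _ _ _) (trans (*-congˡ (*-comm qinv q)) (*-congˡ q·q⁻¹)))
                      (trans (*-identityʳ qinv) det-Minv)

  det-Mpow : ∀ e → qz e ≈ det (Mpow e)
  det-Mpow (+ n)    = sym (trans (det-mpow M n) (pow-cong (sym det-M) n))
  det-Mpow -[1+ n ] = sym (trans (det-mpow Minv (suc n)) (pow-cong (sym det-Minv) (suc n)))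

  Mpow-powers : ∀ e n → mpow (Mpow e) n ≋ linI (Te e n) (Ue e n) (Mpow e)
  Mpow-powers e = cayley-hamilton (Mpow e) (trace-Mpow e) (det-Mpow e)

  U-entry : ∀ n → U n ≈ e12 (mpow M n)
  U-entry n = trans (sym (*-identityʳ (U n))) (sym (eq12 (cayley-hamilton M trace-M det-M n)))

  T-entry : ∀ n → T n ≈ e11 (mpow M n)
  T-entry n = trans (solve 2 (λ t u → t := t :+ u :* con (+ 0)) refl (T n) (U n))
                    (sym (eq11 (cayley-hamilton M trace-M det-M n)))

module Composition {c ℓ} (F : Field c ℓ) (p q : Field.Carrier F) (q≉0 : ¬ (Field._≈_ F q (Field.0# F)))
                   (A B : Lucas.Mat2 F) (Ts Us Tt Ut : Field.Carrier F) where
  open Field F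
  open Lucas F
  open Params p q q≉0
  open Sequences F using (T-suc)
  open Matrices F
  open FieldFacts F
  open IntegerCoefficients commutativeRing
  open import Relation.Binary.Reasoning.Setoid setoid

  a₁ a₂ b₁ b₂ b₃ b₄ c₁ c₂ : Carrier
  a₁ = e11 A
  a₂ = e12 A
  b₁ = e11 B
  b₂ = e12 B
  b₃ = e21 B
  b₄ = e22 B
  c₁ = a₁ * b₂ + a₂ * b₄
  c₂ = a₁ * b₁ + a₂ * b₃

  Ucomp Tcomp : Carrier
  Ucomp = a₂ * Us * Tt + b₂ * Ts * Ut + c₁ * Us * Ut
  Tcomp = Ts * Tt + a₁ * Us * Tt + b₁ * Ts * Ut + c₂ * Us * Ut

  product-e12 : e12 (linI Ts Us A ⊗ linI Tt Ut B) ≈ Ucomp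
  product-e12 = solve 8 (λ a₁ a₂ b₂ b₄ Ts Us Tt Ut →
    (Ts :+ Us :* a₁) :* (Ut :* b₂) :+ Us :* a₂ :* (Tt :+ Ut :* b₄)
    := a₂ :* Us :* Tt :+ b₂ :* Ts :* Ut :+ (a₁ :* b₂ :+ a₂ :* b₄) :* Us :* Ut) refl a₁ a₂ b₂ b₄ Ts Us Tt Ut

  product-e11 : e11 (linI Ts Us A ⊗ linI Tt Ut B) ≈ Tcomp
  product-e11 = solve 8 (λ a₁ a₂ b₁ b₃ Ts Us Tt Ut →
    (Ts :+ Us :* a₁) :* (Tt :+ Ut :* b₁) :+ Us :* a₂ :* (Ut :* b₃)
    := Ts :* Tt :+ a₁ :* Us :* Tt :+ b₁ :* Ts :* Ut :+ (a₁ :* b₁ :+ a₂ :* b₃) :* Us :* Ut) refl a₁ a₂ b₁ b₃ Ts Us Tt Ut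

  -- numerator and denominator of the formula for x_G, as functions of
  -- the accelerated ratios X = x⁽ˢ⁾ and Y = x⁽⁻ᵗ⁾
  numerator denominator : Carrier → Carrier → Carrier
  numerator   X Y = q * q * a₂ * X + q * q * b₂ * Y − q * c₁ * X * Y
  denominator X Y = q * q − q * a₁ * X − q * b₁ * Y + c₂ * X * Y

  -- Substituting X = -q Us / Ts and Y = -q Ut / Tt and clearing the
  -- denominators Ts, Tt turns numerator and denominator into multiples
  -- of the product entries.
  module _ {X Y : Carrier} (X·Ts : X * Ts ≈ - q * Us) (Y·Tt : Y * Tt ≈ - q * Ut) where

    numerator-cleared : numerator X Y * Ts * Tt ≈ - (q * q * q) * Ucomp
    numerator-cleared = begin
      numerator X Y * Ts * Tt
        ≈⟨ solve 8 (λ q a₂ b₂ c₁ X Y Ts Tt →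
             (q :* q :* a₂ :* X :+ q :* q :* b₂ :* Y :- q :* c₁ :* X :* Y) :* Ts :* Tt
             := q :* q :* a₂ :* (X :* Ts) :* Tt :+ q :* q :* b₂ :* Ts :* (Y :* Tt) :- q :* c₁ :* (X :* Ts) :* (Y :* Tt))
             refl q a₂ b₂ c₁ X Y Ts Tt ⟩
      q * q * a₂ * (X * Ts) * Tt + q * q * b₂ * Ts * (Y * Tt) − q * c₁ * (X * Ts) * (Y * Tt)
        ≈⟨ +-cong (+-cong (*-congʳ (*-congˡ X·Ts)) (*-congˡ Y·Tt)) (-‿cong (*-cong (*-congˡ X·Ts) Y·Tt)) ⟩
      q * q * a₂ * (- q * Us) * Tt + q * q * b₂ * Ts * (- q * Ut) − q * c₁ * (- q * Us) * (- q * Ut)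
        ≈⟨ solve 8 (λ q a₂ b₂ c₁ Ts Us Tt Ut →
             q :* q :* a₂ :* (:- q :* Us) :* Tt :+ q :* q :* b₂ :* Ts :* (:- q :* Ut) :- q :* c₁ :* (:- q :* Us) :* (:- q :* Ut)
             := :- (q :* q :* q) :* (a₂ :* Us :* Tt :+ b₂ :* Ts :* Ut :+ c₁ :* Us :* Ut))
             refl q a₂ b₂ c₁ Ts Us Tt Ut ⟩
      - (q * q * q) * Ucomp ∎

    denominator-cleared : denominator X Y * Ts * Tt ≈ q * q * Tcomp
    denominator-cleared = begin
      denominator X Y * Ts * Tt
        ≈⟨ solve 8 (λ q a₁ b₁ c₂ X Y Ts Tt →
             (q :* q :- q :* a₁ :* X :- q :* b₁ :* Y :+ c₂ :* X :* Y) :* Ts :* Tt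
             := q :* q :* Ts :* Tt :- q :* a₁ :* (X :* Ts) :* Tt :- q :* b₁ :* Ts :* (Y :* Tt) :+ c₂ :* (X :* Ts) :* (Y :* Tt))
             refl q a₁ b₁ c₂ X Y Ts Tt ⟩
      q * q * Ts * Tt − q * a₁ * (X * Ts) * Tt − q * b₁ * Ts * (Y * Tt) + c₂ * (X * Ts) * (Y * Tt)
        ≈⟨ +-cong (+-cong (+-congˡ (-‿cong (*-congʳ (*-congˡ X·Ts)))) (-‿cong (*-congˡ Y·Tt)))
                  (*-cong (*-congˡ X·Ts) Y·Tt) ⟩
      q * q * Ts * Tt − q * a₁ * (- q * Us) * Tt − q * b₁ * Ts * (- q * Ut) + c₂ * (- q * Us) * (- q * Ut)
        ≈⟨ solve 8 (λ q a₁ b₁ c₂ Ts Us Tt Ut →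
             q :* q :* Ts :* Tt :- q :* a₁ :* (:- q :* Us) :* Tt :- q :* b₁ :* Ts :* (:- q :* Ut) :+ c₂ :* (:- q :* Us) :* (:- q :* Ut)
             := q :* q :* (Ts :* Tt :+ a₁ :* Us :* Tt :+ b₁ :* Ts :* Ut :+ c₂ :* Us :* Ut))
             refl q a₁ b₁ c₂ Ts Us Tt Ut ⟩
      q * q * Tcomp ∎

    -- If U_G and T_G are the product entries, then x_G = U_G / U_{G-1}
    -- is the numerator over the denominator (using T_G = -q U_{G-1}).
    ratio : ¬ (Ts ≈ 0#) → ¬ (Tt ≈ 0#) → ∀ G → 1 Nat.≤ G → U G ≈ Ucomp → T G ≈ Tcomp →
            (nz : ¬ (U (G ∸ 1) ≈ 0#)) (nzD : ¬ (denominator X Y ≈ 0#)) →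
            x G nz ≈ div (numerator X Y) (denominator X Y) nzD
    ratio Ts≉0 Tt≉0 (suc k) _ U≈ T≈ nz nzD =
      div-cross (U (suc k)) (U k) N D nz nzD (*-cancelʳ Ts≉0 (*-cancelʳ Tt≉0 (begin
        U (suc k) * D * Ts * Tt
          ≈⟨ solve 4 (λ u d s t → u :* d :* s :* t := u :* (d :* s :* t)) refl (U (suc k)) D Ts Tt ⟩
        U (suc k) * (D * Ts * Tt)
          ≈⟨ *-congˡ (trans denominator-cleared (*-congˡ (sym T≈))) ⟩
        U (suc k) * (q * q * T (suc k))
          ≈⟨ *-congˡ (*-congˡ (T-suc p q k)) ⟩
        U (suc k) * (q * q * (- q * U k))
          ≈⟨ solve 3 (λ u q v → u :* (q :* q :* (:- q :* v)) := :- (q :* q :* q) :* u :* v) refl (U (suc k)) q (U k) ⟩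
        - (q * q * q) * U (suc k) * U k
          ≈⟨ *-congʳ (trans (*-congˡ U≈) (sym numerator-cleared)) ⟩
        N * Ts * Tt * U k
          ≈⟨ solve 4 (λ n s t v → n :* s :* t :* v := n :* v :* s :* t) refl N Ts Tt (U k) ⟩
        N * U k * Ts * Tt ∎)))
      where
      N D : Carrier
      N = numerator X Y
      D = denominator X Y

theorem2p6 : ∀ {c ℓ} (F : Field c ℓ) (p q : Field.Carrier F)
    (q≉0 : ¬ (Field._≈_ F q (Field.0# F))) →
    let open Field F
        open Lucas F
        open Params p q q≉0
    in (i j s t : ℤ) → + 2 ℤ.≤ i → + 2 ℤ.≤ j →
    let g  = Wℤ i j s t
        Ms = Mpow s
        Mt = Mpow (ℤ.- t)
        a₁ = e11 Ms
        a₂ = e12 Ms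
        b₁ = e11 Mt
        b₂ = e12 Mt
        b₃ = e21 Mt
        b₄ = e22 Mt
    in (m : ℕ) → + 0 ℤ.≤ g m → + 0 ℤ.≤ g (suc m) → + 0 ℤ.≤ g (suc (suc m)) →
    let G = ∣ g (suc (suc m)) ∣
        A = ∣ g (suc m) ∣
        B = ∣ g m ∣
    in (U G ≈ a₂ * Ue s A * Te (ℤ.- t) B + b₂ * Te s A * Ue (ℤ.- t) B
               + (a₁ * b₂ + a₂ * b₄) * Ue s A * Ue (ℤ.- t) B)
     × (T G ≈ Te s A * Te (ℤ.- t) B + a₁ * Ue s A * Te (ℤ.- t) B
               + b₁ * Te s A * Ue (ℤ.- t) B
               + (a₁ * b₁ + a₂ * b₃) * Ue s A * Ue (ℤ.- t) B)
     × (2 Data.Nat.≤ G →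
        (nz : ¬ (U (G ∸ 1) ≈ 0#)) →
        (nzs : ¬ (Te s A ≈ 0#)) →
        (nzt : ¬ (Te (ℤ.- t) B ≈ 0#)) →
        let X = xe s A nzs
            Y = xe (ℤ.- t) B nzt
            N = q * q * a₂ * X + q * q * b₂ * Y − q * (a₁ * b₂ + a₂ * b₄) * X * Y
            D = q * q − q * a₁ * X − q * b₁ * Y + (a₁ * b₁ + a₂ * b₃) * X * Y
        in (nzD : ¬ (D ≈ 0#)) → x G nz ≈ div N D nzD)
theorem2p6 F p q q≉0 i j s t _ _ m g₀≥0 g₁≥0 g₂≥0 = U-formula , T-formula , x-formula
  where
  open Field F
  open Lucas F
  open Params p q q≉0
  open Matrices F
  open FieldFacts F using (div-*-cancel)
  open LucasMatrix F p q q≉0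
  g : ℕ → ℤ
  g = Wℤ i j s t
  G A B : ℕ
  G = ∣ g (suc (suc m)) ∣
  A = ∣ g (suc m) ∣
  B = ∣ g m ∣
  open Composition F p q q≉0 (Mpow s) (Mpow (ℤ.- t)) (Te s A) (Ue s A) (Te (ℤ.- t) B) (Ue (ℤ.- t) B)

  -- the recurrence of g, read on the nonnegative terms: G = sA - tB
  exponent : + G ≡ s ℤ.* + A ℤ.- t ℤ.* + B
  exponent = P.trans (ℤP.0≤i⇒+∣i∣≡i g₂≥0)
    (P.cong₂ (λ a b → s ℤ.* a ℤ.- t ℤ.* b) (P.sym (ℤP.0≤i⇒+∣i∣≡i g₁≥0)) (P.sym (ℤP.0≤i⇒+∣i∣≡i g₀≥0)))

  factorisation : mpow M G ≋ linI (Te s A) (Ue s A) (Mpow s) ⊗ linI (Te (ℤ.- t) B) (Ue (ℤ.- t) B) (Mpow (ℤ.- t))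
  factorisation = ≋-trans (Mpow-split s t G A B exponent) (⊗-cong (Mpow-powers s A) (Mpow-powers (ℤ.- t) B))

  U-formula : U G ≈ Ucomp
  U-formula = trans (U-entry G) (trans (eq12 factorisation) product-e12)

  T-formula : T G ≈ Tcomp
  T-formula = trans (T-entry G) (trans (eq11 factorisation) product-e11)

  x-formula : 2 Nat.≤ G → (nz : ¬ (U (G ∸ 1) ≈ 0#)) (nzs : ¬ (Te s A ≈ 0#)) (nzt : ¬ (Te (ℤ.- t) B ≈ 0#)) →
              (nzD : ¬ (denominator (xe s A nzs) (xe (ℤ.- t) B nzt) ≈ 0#)) →
              x G nz ≈ div (numerator (xe s A nzs) (xe (ℤ.- t) B nzt)) (denominator (xe s A nzs) (xe (ℤ.- t) B nzt)) nzD
  x-formula 2≤G nz nzs nzt =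
    ratio (div-*-cancel _ _ nzs) (div-*-cancel _ _ nzt) nzs nzt G (NatP.<⇒≤ 2≤G) U-formula T-formula nz
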